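{- Let $q=p^k$ be a prime power. The group $\Gamma\mathrm{L}(2,q)$ acting on the non-zero vectors of $\mathbb{F}_q^2$ has the EKR property: every intersecting set of $\Gamma\mathrm{L}(2,q)$ has size at most $\frac{|\Gamma\mathrm{L}(2,q)|}{q^2-1}$, the size of the stabilizer of a non-zero vector.
   Context: $\varphi:x\mapsto x^p$ is the Frobenius automorphism of $\mathbb{F}_q$. $\Gamma\mathrm{L}(2,q)$ is the group of maps $v\mapsto Av^{\varphi^i}$ ($A\in\mathrm{GL}(2,q)$, $0\le i\le k-1$, with $\varphi^i$ applied entrywise) under composition. A subset $\mathcal{F}$ is intersecting if for all $g,h\in\mathcal{F}$ there is a non-zero $v$ with $g(v)=h(v)$. -}

module Defs where

open import Level using (0ℓ)
open import Data.Nat using (ℕ; zero; suc; _^_)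
open import Data.Fin using (Fin)
open import Data.Product using (_×_; _,_; Σ; ∃)
open import Data.List using (List; length; filter; map; concatMap; cartesianProduct)
open import Data.List.Membership.Propositional using (_∈_)
open import Data.List.Relation.Unary.Unique.Propositional using (Unique)
open import Relation.Nullary using (¬_; ¬?)
open import Relation.Binary.PropositionalEquality using (_≡_; _≢_)
open import Relation.Binary.Definitions using (DecidableEquality)
open import Algebra.Structures using (IsCommutativeRing)

record FiniteField : Set₁ where
  infixl 7 _*_
  infixl 6 _+_
  field
    Carrier : Set
    _+_ _*_ : Carrier → Carrier → Carrier
    -_ : Carrier → Carrier
    0# 1# : Carrier
    isCommutativeRing : IsCommutativeRing _≡_ _+_ _*_ -_ 0# 1#
    0≢1 : 0# ≢ 1#
    _⁻¹ : Carrier → Carrier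
    inverseʳ : ∀ x → x ≢ 0# → x * (x ⁻¹) ≡ 1#
    _≟_ : DecidableEquality Carrier
    elements : List Carrier
    complete : ∀ x → x ∈ elements
    unique : Unique elements

  order : ℕ
  order = length elements

  pow : Carrier → ℕ → Carrier
  pow x zero = 1#
  pow x (suc n) = x * pow x n

  Mat : Set
  Mat = Carrier × Carrier × Carrier × Carrier

  Vec2 : Set
  Vec2 = Carrier × Carrier

  det : Mat → Carrier
  det (a , b , c , d) = a * d + - (b * c)

  Invertible : Mat → Set
  Invertible A = det A ≢ 0#

  allMats : List Mat
  allMats = cartesianProduct elements
              (cartesianProduct elements (cartesianProduct elements elements))

  GL2 : List Mat
  GL2 = filter (λ A → ¬? (det A ≟ 0#)) allMats

module _ (𝔽 : FiniteField) (p k : ℕ) where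
  open FiniteField 𝔽

  -- Elements of ΓL(2,q): pairs (A , i), A ∈ GL(2,q), 0 ≤ i ≤ k-1,
  -- representing the map v ↦ A v^{φ^i}, where φ : x ↦ x^p.
  ΓL : Set
  ΓL = Mat × Fin k

  frob^ : Data.Nat.ℕ → Carrier → Carrier
  frob^ i x = pow x (p ^ i)

  apply : ΓL → Vec2 → Vec2
  apply ((a , b , c , d) , i) (x , y) =
    let x' = frob^ (Data.Fin.toℕ i) x
        y' = frob^ (Data.Fin.toℕ i) y
    in (a * x' + b * y' , c * x' + d * y')

  |ΓL| : ℕ
  |ΓL| = length GL2 Data.Nat.* k

  NonZero2 : Vec2 → Set
  NonZero2 v = ¬ (v ≡ (0# , 0#))

  Intersecting : List ΓL → Set
  Intersecting 𝓕 = ∀ {g h} → g ∈ 𝓕 → h ∈ 𝓕 →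
                   Σ Vec2 (λ v → NonZero2 v × (apply g v ≡ apply h v))

{-# OPTIONS --safe #-}
module Submission where

-- Pick a monic irreducible quadratic X² + t X + n over 𝔽_q: the map (r , s) ↦ (- (r + s) , r s)
-- identifies (0 , 1) and (1 , 0), so on the finite set 𝔽_q² it misses some (t , n), and a missed
-- (t , n) has no root. The matrices σ (u , v) = u I + v C, with C the companion matrix, form a
-- copy of 𝔽_{q²}: they are closed under subtraction and invertible unless (u , v) = 0. For an
-- intersecting family 𝓕 the map (g , s) ↦ g σ(s) on 𝓕 × (𝔽_q² ∖ 0) is injective: if
-- A₁ σ(s₁) = A₂ σ(s₂) and A₁, A₂ agree on a nonzero vector, then A₂ σ(s₂ - s₁) = (A₁ - A₂) σ(s₁)
-- is singular, which forces s₁ = s₂ and then A₁ = A₂.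

open import Defs
open import Level using (0ℓ)
open import Algebra.Bundles using (CommutativeRing)
open import Algebra.Solver.Ring.AlmostCommutativeRing
  using (fromCommutativeRing; _-Raw-AlmostCommutative⟶_)
open import Data.Integer as ℤ using (ℤ; +_; -[1+_]; _⊖_)
import Data.Integer.Properties as ℤ
import Data.Maybe as Maybe
open import Data.Sign as Sign using (Sign)
open import Data.Empty using (⊥-elim)
open import Data.Fin using (Fin; toℕ)
open import Data.Product.Properties using (≡-dec; ,-injective; ,-injectiveˡ; ,-injectiveʳ)
open import Data.List using (List; []; _∷_; length; map; filter; allFin; _++_; cartesianProduct)
open import Data.List.Membership.Propositional using (_∈_)
open import Data.List.Membership.Propositional.Properties
  using (∈-map⁻; ∈-cartesianProduct⁺; ∈-cartesianProduct⁻; ∈-filter⁺; ∈-filter⁻; ∈-allFin)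
open import Data.List.Properties using (length-++; length-map; length-removeAt′; length-tabulate)
open import Data.List.Relation.Unary.All as All using (All)
open import Data.List.Relation.Unary.Any as Any using (here; there; _─_; any?; satisfied)
open import Data.List.Relation.Unary.AllPairs using ([]; _∷_)
open import Data.List.Relation.Unary.Unique.Propositional using (Unique)
import Data.List.Relation.Unary.Unique.Propositional.Properties as Unique
open import Data.Nat as ℕ using (ℕ; zero; suc; _^_; _∸_; _≤_; _≥_; z≤n; s≤s)
open import Data.Nat.Primality using (Prime)
open import Data.Nat.Properties using (1+n≰n; +-suc; *-monoʳ-≤; ∸-monoˡ-≤; module ≤-Reasoning)
open import Data.Product using (∃; ∃₂; Σ; _×_; _,_; proj₁; proj₂; uncurry)
open import Function using (id; _∘_; _∋_)
open import Relation.Binary.Definitions using (DecidableEquality)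
open import Relation.Binary.PropositionalEquality
  using (_≡_; _≢_; refl; sym; trans; cong; cong₂; subst; module ≡-Reasoning)
open import Relation.Nullary using (Dec; yes; no; ¬?; dec⇒maybe)
open import Relation.Nullary.Decidable using (map′; decidable-stable)
open import Relation.Unary using (Decidable)

module _ {A B : Set} where

  MapsInto : (A → B) → List A → List B → Set
  MapsInto f xs ys = ∀ {x} → x ∈ xs → f x ∈ ys

  InjectiveOn : (A → B) → List A → Set
  InjectiveOn f xs = ∀ {x y} → x ∈ xs → y ∈ xs → f x ≡ f y → x ≡ y

  length-cartesianProduct : (xs : List A) (ys : List B) →
                            length (cartesianProduct xs ys) ≡ length xs ℕ.* length ys
  length-cartesianProduct []       ys = refl
  length-cartesianProduct (x ∷ xs) ys = begin
    length (map (x ,_) ys ++ cartesianProduct xs ys)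
      ≡⟨ length-++ (map (x ,_) ys) ⟩
    length (map (x ,_) ys) ℕ.+ length (cartesianProduct xs ys)
      ≡⟨ cong₂ ℕ._+_ (length-map (x ,_) ys) (length-cartesianProduct xs ys) ⟩
    length ys ℕ.+ length xs ℕ.* length ys
      ∎
    where open ≡-Reasoning

∈-─⁺ : {A : Set} {x y : A} {ys : List A} (x∈ys : x ∈ ys) → y ∈ ys → y ≢ x → y ∈ (ys ─ x∈ys)
∈-─⁺ (here refl)  (here refl)  y≢x = ⊥-elim (y≢x refl)
∈-─⁺ (here refl)  (there y∈ys) _   = y∈ys
∈-─⁺ (there _)    (here refl)  _   = here refl
∈-─⁺ (there x∈ys) (there y∈ys) y≢x = there (∈-─⁺ x∈ys y∈ys y≢x)

injectiveOn⇒length≤ : {A B : Set} (f : A → B) {xs : List A} {ys : List B} → Unique xs →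
                      MapsInto f xs ys → InjectiveOn f xs → length xs ≤ length ys
injectiveOn⇒length≤ f []                          _    _   = z≤n
injectiveOn⇒length≤ f {x ∷ xs} {ys} (x∉xs ∷ xs!) into inj = begin
  suc (length xs)           ≤⟨ s≤s (injectiveOn⇒length≤ f xs! into′ (λ p q → inj (there p) (there q))) ⟩
  suc (length (ys ─ fx∈ys)) ≡⟨ sym (length-removeAt′ ys (Any.index fx∈ys)) ⟩
  length ys                 ∎
  where
  open ≤-Reasoning
  fx∈ys : f x ∈ ys
  fx∈ys = into (here refl)
  into′ : MapsInto f xs (ys ─ fx∈ys)
  into′ z∈xs = ∈-─⁺ fx∈ys (into (there z∈xs))
                 (λ fz≡fx → All.lookup x∉xs z∈xs (sym (inj (there z∈xs) (here refl) fz≡fx)))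

Unique⇒length≤ : {A : Set} {xs ys : List A} → Unique xs → (∀ {x} → x ∈ xs → x ∈ ys) → length xs ≤ length ys
Unique⇒length≤ xs! xs⊆ys = injectiveOn⇒length≤ id xs! xs⊆ys (λ _ _ → id)

module FiniteSet {A : Set} (_≟_ : DecidableEquality A) {xs : List A}
                 (xs! : Unique xs) (complete : ∀ x → x ∈ xs) where

  ∃? : {P : A → Set} → Decidable P → Dec (∃ P)
  ∃? {P} P? = map′ satisfied (λ (x , px) → Any.map (λ x≡y → subst P x≡y px) (complete x)) (any? P? xs)

  injective⇒surjective : {f : A → A} → (∀ {x y} → f x ≡ f y → x ≡ y) → ∀ y → ∃ λ x → f x ≡ y
  injective⇒surjective {f} f-inj y with ∃? (λ x → f x ≟ y)
  ... | yes hit = hit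
  ... | no miss = ⊥-elim (1+n≰n (subst (λ m → suc m ≤ length xs) (length-map f xs)
                                  (Unique⇒length≤ (y∉image ∷ Unique.map⁺ f-inj xs!) (λ {z} _ → complete z))))
    where
    y∉image : All (y ≢_) (map f xs)
    y∉image = All.tabulate λ fx∈ y≡fx → let (x , _ , fx≡) = ∈-map⁻ f fx∈ in miss (x , sym (trans y≡fx fx≡))

  -- A section of a non-injective f would be an injection that is not surjective.
  noninjective⇒missesValue : {f : A → A} {a b : A} → f a ≡ f b → a ≢ b → ∃ λ y → ∀ x → f x ≢ y
  noninjective⇒missesValue {f} {a} {b} fa≡fb a≢b with ∃? (λ y → ¬? (∃? (λ x → f x ≟ y)))
  ... | yes (y , miss) = y , λ x fx≡y → miss (x , fx≡y)
  ... | no ¬miss = ⊥-elim (a≢b a≡b)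
    where
    section : ∀ y → ∃ λ x → f x ≡ y
    section y = decidable-stable (∃? (λ x → f x ≟ y)) (λ miss → ¬miss (y , miss))
    g : A → A
    g = proj₁ ∘ section
    g-injective : ∀ {y₁ y₂} → g y₁ ≡ g y₂ → y₁ ≡ y₂
    g-injective {y₁} {y₂} e = trans (sym (proj₂ (section y₁))) (trans (cong f e) (proj₂ (section y₂)))
    a≡b : a ≡ b
    a≡b with injective⇒surjective g-injective a | injective⇒surjective g-injective b
    ... | y₁ , refl | y₂ , refl =
      cong g (trans (sym (proj₂ (section y₁))) (trans fa≡fb (proj₂ (section y₂))))

-- The ring solver over an arbitrary commutative ring, with integer coefficients mapped in by the
-- canonical morphism ℤ → R; unlike Algebra.Solver.Ring.Simple, coefficient equality then computes.
module IntegerCoefficients {a ℓ} (R : CommutativeRing a ℓ) where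
  open CommutativeRing R renaming (refl to ≈-refl; sym to ≈-sym; trans to ≈-trans)
  open import Algebra.Properties.Ring ring
    using (-‿involutive; -‿anti-homo-+; -‿+-comm; -0#≈0#; -1*x≈-x; xyx⁻¹≈y)
  open import Algebra.Properties.Semiring.Mult semiring
    using (×-homo-+; ×1-homo-*) renaming (_×_ to _×ₙ_)
  open import Algebra.Properties.CommutativeSemigroup *-commutativeSemigroup using (interchange)
  open import Relation.Binary.Reasoning.Setoid setoid

  fromℤ : ℤ → Carrier
  fromℤ (+ n)      = n ×ₙ 1#
  fromℤ -[1+ n ]   = - (suc n ×ₙ 1#)

  1+x-[1+y]≈x-y : ∀ x y → (1# + x) - (1# + y) ≈ x - y
  1+x-[1+y]≈x-y x y = begin
    (1# + x) + - (1# + y)    ≈⟨ +-congˡ (-‿anti-homo-+ 1# y) ⟩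
    (1# + x) + (- y + - 1#)  ≈⟨ +-assoc (1# + x) (- y) (- 1#) ⟨
    (1# + x) + - y + - 1#    ≈⟨ +-congʳ (+-assoc 1# x (- y)) ⟩
    1# + (x - y) + - 1#      ≈⟨ xyx⁻¹≈y 1# (x - y) ⟩
    x - y                    ∎

  fromℤ-⊖ : ∀ m n → fromℤ (m ⊖ n) ≈ m ×ₙ 1# - n ×ₙ 1#
  fromℤ-⊖ m       zero    = ≈-sym (≈-trans (+-congˡ -0#≈0#) (+-identityʳ (m ×ₙ 1#)))
  fromℤ-⊖ zero    (suc n) = ≈-sym (+-identityˡ _)
  fromℤ-⊖ (suc m) (suc n) = begin
    fromℤ (suc m ⊖ suc n)            ≡⟨ cong fromℤ (ℤ.[1+m]⊖[1+n]≡m⊖n m n) ⟩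
    fromℤ (m ⊖ n)                    ≈⟨ fromℤ-⊖ m n ⟩
    m ×ₙ 1# - n ×ₙ 1#                ≈⟨ 1+x-[1+y]≈x-y (m ×ₙ 1#) (n ×ₙ 1#) ⟨
    (1# + m ×ₙ 1#) - (1# + n ×ₙ 1#)  ∎

  fromℤ-+ : ∀ i j → fromℤ (i ℤ.+ j) ≈ fromℤ i + fromℤ j
  fromℤ-+ -[1+ m ] -[1+ n ] = begin
    - (suc (suc (m ℕ.+ n)) ×ₙ 1#)      ≡⟨ cong (λ k → - (suc k ×ₙ 1#)) (+-suc m n) ⟨
    - ((suc m ℕ.+ suc n) ×ₙ 1#)        ≈⟨ -‿cong (×-homo-+ 1# (suc m) (suc n)) ⟩
    - (suc m ×ₙ 1# + suc n ×ₙ 1#)      ≈⟨ -‿+-comm (suc m ×ₙ 1#) (suc n ×ₙ 1#) ⟨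
    - (suc m ×ₙ 1#) + - (suc n ×ₙ 1#)  ∎
  fromℤ-+ -[1+ m ] (+ n)    = ≈-trans (fromℤ-⊖ n (suc m)) (+-comm _ _)
  fromℤ-+ (+ m)    -[1+ n ] = fromℤ-⊖ m (suc n)
  fromℤ-+ (+ m)    (+ n)    = ×-homo-+ 1# m n

  fromℤ-‿ : ∀ i → fromℤ (ℤ.- i) ≈ - fromℤ i
  fromℤ-‿ -[1+ n ]     = ≈-sym (-‿involutive _)
  fromℤ-‿ (+ zero)     = ≈-sym -0#≈0#
  fromℤ-‿ (+ (suc n))  = ≈-refl

  signᶜ : Sign → Carrier
  signᶜ Sign.+ = 1#
  signᶜ Sign.- = - 1#

  signᶜ-* : ∀ s t → signᶜ (s Sign.* t) ≈ signᶜ s * signᶜ t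
  signᶜ-* Sign.+ t      = ≈-sym (*-identityˡ _)
  signᶜ-* Sign.- Sign.+ = ≈-sym (*-identityʳ _)
  signᶜ-* Sign.- Sign.- = ≈-sym (≈-trans (-1*x≈-x _) (-‿involutive _))

  fromℤ-◃ : ∀ s n → fromℤ (s ℤ.◃ n) ≈ signᶜ s * (n ×ₙ 1#)
  fromℤ-◃ s      zero    = ≈-sym (zeroʳ _)
  fromℤ-◃ Sign.+ (suc n) = ≈-sym (*-identityˡ _)
  fromℤ-◃ Sign.- (suc n) = ≈-sym (-1*x≈-x _)

  fromℤ-signAbs : ∀ i → fromℤ i ≈ signᶜ (ℤ.sign i) * (ℤ.∣ i ∣ ×ₙ 1#)
  fromℤ-signAbs (+ n)    = ≈-sym (*-identityˡ _)
  fromℤ-signAbs -[1+ n ] = ≈-sym (-1*x≈-x _)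

  fromℤ-* : ∀ i j → fromℤ (i ℤ.* j) ≈ fromℤ i * fromℤ j
  fromℤ-* i j = begin
    fromℤ (sᵢ Sign.* sⱼ ℤ.◃ nᵢ ℕ.* nⱼ)           ≈⟨ fromℤ-◃ (sᵢ Sign.* sⱼ) (nᵢ ℕ.* nⱼ) ⟩
    signᶜ (sᵢ Sign.* sⱼ) * ((nᵢ ℕ.* nⱼ) ×ₙ 1#)    ≈⟨ *-cong (signᶜ-* sᵢ sⱼ) (×1-homo-* nᵢ nⱼ) ⟩
    signᶜ sᵢ * signᶜ sⱼ * (nᵢ ×ₙ 1# * nⱼ ×ₙ 1#)   ≈⟨ interchange (signᶜ sᵢ) (signᶜ sⱼ) (nᵢ ×ₙ 1#) (nⱼ ×ₙ 1#) ⟩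
    signᶜ sᵢ * nᵢ ×ₙ 1# * (signᶜ sⱼ * nⱼ ×ₙ 1#)   ≈⟨ *-cong (fromℤ-signAbs i) (fromℤ-signAbs j) ⟨
    fromℤ i * fromℤ j                             ∎
    where
    sᵢ sⱼ : Sign
    sᵢ = ℤ.sign i
    sⱼ = ℤ.sign j
    nᵢ nⱼ : ℕ
    nᵢ = ℤ.∣ i ∣
    nⱼ = ℤ.∣ j ∣

  fromℤ-morphism : ℤ.+-*-rawRing -Raw-AlmostCommutative⟶ fromCommutativeRing R
  fromℤ-morphism = record
    { ⟦_⟧    = fromℤ
    ; +-homo = fromℤ-+
    ; *-homo = fromℤ-*
    ; -‿homo = fromℤ-‿
    ; 0-homo = ≈-refl
    ; 1-homo = +-identityʳ 1#
    }

  open import Algebra.Solver.Ring ℤ.+-*-rawRing (fromCommutativeRing R) fromℤ-morphism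
    (λ i j → Maybe.map (reflexive ∘ cong fromℤ) (dec⇒maybe (i ℤ.≟ j))) public

module Field (𝔽 : FiniteField) where
  open FiniteField 𝔽

  commutativeRing : CommutativeRing 0ℓ 0ℓ
  commutativeRing = record { isCommutativeRing = isCommutativeRing }

  open CommutativeRing commutativeRing
    using (+-comm; *-comm; +-identityʳ; *-identityˡ; *-identityʳ; zeroˡ; zeroʳ; -‿inverseʳ; ring)
  open import Algebra.Properties.Ring ring using (x∙y⁻¹≈ε⇒x≈y; -0#≈0#)
  open IntegerCoefficients commutativeRing using (solve; _:=_; _:+_; _:-_; _:*_; :-_; con)
  open ≡-Reasoning

  infixl 6 _-_
  _-_ : Carrier → Carrier → Carrier
  x - y = x + - y

  x-y≡0⇒x≡y : ∀ {x y} → x - y ≡ 0# → x ≡ y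
  x-y≡0⇒x≡y = x∙y⁻¹≈ε⇒x≈y _ _

  x*y≡0⇒y≡0 : ∀ {x y} → x ≢ 0# → x * y ≡ 0# → y ≡ 0#
  x*y≡0⇒y≡0 {x} {y} x≢0 xy≡0 = begin
    y               ≡⟨ sym (*-identityˡ y) ⟩
    1# * y          ≡⟨ cong (_* y) (sym (inverseʳ x x≢0)) ⟩
    x * x ⁻¹ * y    ≡⟨ solve 3 (λ x x′ y → x :* x′ :* y := x′ :* (x :* y)) refl x (x ⁻¹) y ⟩
    x ⁻¹ * (x * y)  ≡⟨ cong (x ⁻¹ *_) xy≡0 ⟩
    x ⁻¹ * 0#       ≡⟨ zeroʳ (x ⁻¹) ⟩
    0#              ∎

  x*y≡0⇒x≡0 : ∀ {x y} → y ≢ 0# → x * y ≡ 0# → x ≡ 0#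
  x*y≡0⇒x≡0 {x} {y} y≢0 xy≡0 = x*y≡0⇒y≡0 y≢0 (trans (*-comm y x) xy≡0)

  *-nonzero : ∀ {x y} → x ≢ 0# → y ≢ 0# → x * y ≢ 0#
  *-nonzero x≢0 y≢0 xy≡0 = y≢0 (x*y≡0⇒y≡0 x≢0 xy≡0)

  *-cancelˡ : ∀ {x y z} → x ≢ 0# → x * y ≡ x * z → y ≡ z
  *-cancelˡ {x} {y} {z} x≢0 xy≡xz = x-y≡0⇒x≡y (x*y≡0⇒y≡0 x≢0 (begin
    x * (y - z)      ≡⟨ solve 3 (λ x y z → x :* (y :- z) := x :* y :- x :* z) refl x y z ⟩
    x * y - x * z    ≡⟨ cong (_- x * z) xy≡xz ⟩
    x * z - x * z    ≡⟨ -‿inverseʳ (x * z) ⟩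
    0#               ∎))

  pow≡0⇒≡0 : ∀ {x} m → pow x m ≡ 0# → x ≡ 0#
  pow≡0⇒≡0 zero    1≡0   = ⊥-elim (0≢1 (sym 1≡0))
  pow≡0⇒≡0 {x} (suc m) xxᵐ≡0 with x ≟ 0#
  ... | yes x≡0 = x≡0
  ... | no  x≢0 = pow≡0⇒≡0 m (x*y≡0⇒y≡0 x≢0 xxᵐ≡0)

  0ᵥ : Vec2
  0ᵥ = (0# , 0#)

  infixl 6 _-ᵥ_
  _-ᵥ_ : Vec2 → Vec2 → Vec2
  (x , y) -ᵥ (x′ , y′) = (x - x′ , y - y′)

  _≟ᵥ_ : DecidableEquality Vec2
  _≟ᵥ_ = ≡-dec _≟_ _≟_

  x-ᵥx≡0ᵥ : ∀ v → v -ᵥ v ≡ 0ᵥ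
  x-ᵥx≡0ᵥ (x , y) = cong₂ _,_ (-‿inverseʳ x) (-‿inverseʳ y)

  x-ᵥy≡0ᵥ⇒x≡y : ∀ {v w} → v -ᵥ w ≡ 0ᵥ → v ≡ w
  x-ᵥy≡0ᵥ⇒x≡y v-w≡0 = cong₂ _,_ (x-y≡0⇒x≡y (,-injectiveˡ v-w≡0)) (x-y≡0⇒x≡y (,-injectiveʳ v-w≡0))

  vecs : List Vec2
  vecs = cartesianProduct elements elements

  ∈-vecs : ∀ v → v ∈ vecs
  ∈-vecs (x , y) = ∈-cartesianProduct⁺ (complete x) (complete y)

  vecs! : Unique vecs
  vecs! = Unique.cartesianProduct⁺ unique unique

  Irreducible : Carrier → Carrier → Set
  Irreducible t n = ∀ r → r * r + t * r + n ≢ 0#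

  -- (r , s) ↦ the coefficients (t , n) of (X - r) (X - s) = X² + t X + n.
  vieta : Vec2 → Vec2
  vieta (r , s) = (- (r + s) , r * s)

  vieta-root : ∀ {t n} r → r * r + t * r + n ≡ 0# → vieta (r , - t - r) ≡ (t , n)
  vieta-root {t} {n} r root = cong₂ _,_
    (solve 2 (λ r t → :- (r :+ (:- t :- r)) := t) refl r t)
    (x-y≡0⇒x≡y (begin
      r * (- t - r) - n        ≡⟨ solve 3 (λ r t n → r :* (:- t :- r) :- n := :- (r :* r :+ t :* r :+ n)) refl r t n ⟩
      - (r * r + t * r + n)    ≡⟨ cong -_ root ⟩
      - 0#                     ≡⟨ -0#≈0# ⟩
      0#                       ∎))

  vieta-swap : vieta (0# , 1#) ≡ vieta (1# , 0#)
  vieta-swap = cong₂ _,_ (cong -_ (+-comm 0# 1#)) (*-comm 0# 1#)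

  ∃-irreducible : ∃₂ Irreducible
  ∃-irreducible with FiniteSet.noninjective⇒missesValue _≟ᵥ_ vecs! ∈-vecs {vieta} vieta-swap (0≢1 ∘ ,-injectiveˡ)
  ... | (t , n) , missed = t , n , λ r root → missed (r , - t - r) (vieta-root r root)

  Mat≡ : ∀ {a b c d a′ b′ c′ d′} → a ≡ a′ → b ≡ b′ → c ≡ c′ → d ≡ d′ →
         (Mat ∋ (a , b , c , d)) ≡ (a′ , b′ , c′ , d′)
  Mat≡ refl refl refl refl = refl

  infixl 7 _·_ _·ᵥ_ _*ₘ_
  infixl 6 _-ₘ_

  _·_ : Mat → Mat → Mat
  (a , b , c , d) · (e , f , g , h) = (a * e + b * g , a * f + b * h , c * e + d * g , c * f + d * h)

  _·ᵥ_ : Mat → Vec2 → Vec2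
  (a , b , c , d) ·ᵥ (x , y) = (a * x + b * y , c * x + d * y)

  _-ₘ_ : Mat → Mat → Mat
  (a , b , c , d) -ₘ (a′ , b′ , c′ , d′) = (a - a′ , b - b′ , c - c′ , d - d′)

  _*ₘ_ : Carrier → Mat → Mat
  x *ₘ (a , b , c , d) = (x * a , x * b , x * c , x * d)

  adj : Mat → Mat
  adj (a , b , c , d) = (d , - b , - c , a)

  dot-distribˡ-‿ : ∀ a b a′ b′ x y → (a - a′) * x + (b - b′) * y ≡ (a * x + b * y) - (a′ * x + b′ * y)
  dot-distribˡ-‿ = solve 6 (λ a b a′ b′ x y →
    (a :- a′) :* x :+ (b :- b′) :* y := (a :* x :+ b :* y) :- (a′ :* x :+ b′ :* y)) refl

  dot-distribʳ-‿ : ∀ a b x y x′ y′ → a * (x - x′) + b * (y - y′) ≡ (a * x + b * y) - (a * x′ + b * y′)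
  dot-distribʳ-‿ = solve 6 (λ a b x y x′ y′ →
    a :* (x :- x′) :+ b :* (y :- y′) := (a :* x :+ b :* y) :- (a :* x′ :+ b :* y′)) refl

  ·-distribʳ-‿ : ∀ A B C → (A -ₘ B) · C ≡ A · C -ₘ B · C
  ·-distribʳ-‿ (a , b , c , d) (a′ , b′ , c′ , d′) (e , f , g , h) =
    Mat≡ (dot-distribˡ-‿ a b a′ b′ e g) (dot-distribˡ-‿ a b a′ b′ f h)
         (dot-distribˡ-‿ c d c′ d′ e g) (dot-distribˡ-‿ c d c′ d′ f h)

  ·-distribˡ-‿ : ∀ A B C → A · (B -ₘ C) ≡ A · B -ₘ A · C
  ·-distribˡ-‿ (a , b , c , d) (e , f , g , h) (e′ , f′ , g′ , h′) =
    Mat≡ (dot-distribʳ-‿ a b e g e′ g′) (dot-distribʳ-‿ a b f h f′ h′)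
         (dot-distribʳ-‿ c d e g e′ g′) (dot-distribʳ-‿ c d f h f′ h′)

  ·ᵥ-distribʳ-‿ : ∀ A B w → (A -ₘ B) ·ᵥ w ≡ A ·ᵥ w -ᵥ B ·ᵥ w
  ·ᵥ-distribʳ-‿ (a , b , c , d) (a′ , b′ , c′ , d′) (x , y) =
    cong₂ _,_ (dot-distribˡ-‿ a b a′ b′ x y) (dot-distribˡ-‿ c d c′ d′ x y)

  ·ᵥ-zeroʳ : ∀ A → A ·ᵥ 0ᵥ ≡ 0ᵥ
  ·ᵥ-zeroʳ (a , b , c , d) = cong₂ _,_ (dot-zeroʳ a b) (dot-zeroʳ c d)
    where
    dot-zeroʳ : ∀ a b → a * 0# + b * 0# ≡ 0#
    dot-zeroʳ a b = trans (cong₂ _+_ (zeroʳ a) (zeroʳ b)) (+-identityʳ 0#)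

  det-· : ∀ A B → det (A · B) ≡ det A * det B
  det-· (a , b , c , d) (e , f , g , h) = solve 8 (λ a b c d e f g h →
    (a :* e :+ b :* g) :* (c :* f :+ d :* h) :- (a :* f :+ b :* h) :* (c :* e :+ d :* g)
      := (a :* d :- b :* c) :* (e :* h :- f :* g)) refl a b c d e f g h

  adj-·ᵥ : ∀ A x y → adj A ·ᵥ (A ·ᵥ (x , y)) ≡ (det A * x , det A * y)
  adj-·ᵥ (a , b , c , d) x y = cong₂ _,_
    (solve 6 (λ a b c d x y → d :* (a :* x :+ b :* y) :+ :- b :* (c :* x :+ d :* y)
                                := (a :* d :- b :* c) :* x) refl a b c d x y)
    (solve 6 (λ a b c d x y → :- c :* (a :* x :+ b :* y) :+ a :* (c :* x :+ d :* y)
                                := (a :* d :- b :* c) :* y) refl a b c d x y)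

  ·-adj : ∀ A M → A · M · adj M ≡ det M *ₘ A
  ·-adj (a , b , c , d) (e , f , g , h) = Mat≡ (row₁ a b) (row₂ a b) (row₁ c d) (row₂ c d)
    where
    row₁ : ∀ a b → (a * e + b * g) * h + (a * f + b * h) * - g ≡ (e * h - f * g) * a
    row₁ a b = solve 6 (λ a b e f g h → (a :* e :+ b :* g) :* h :+ (a :* f :+ b :* h) :* :- g
                                          := (e :* h :- f :* g) :* a) refl a b e f g h
    row₂ : ∀ a b → (a * e + b * g) * - f + (a * f + b * h) * e ≡ (e * h - f * g) * b
    row₂ a b = solve 6 (λ a b e f g h → (a :* e :+ b :* g) :* :- f :+ (a :* f :+ b :* h) :* e
                                          := (e :* h :- f :* g) :* b) refl a b e f g h

  annihilator-of-nonzero≡0 : ∀ {d x y} → d * x ≡ 0# → d * y ≡ 0# → (x , y) ≢ 0ᵥ → d ≡ 0#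
  annihilator-of-nonzero≡0 {d} {x} {y} dx≡0 dy≡0 w≢0 with x ≟ 0# | y ≟ 0#
  ... | no x≢0   | _        = x*y≡0⇒x≡0 x≢0 dx≡0
  ... | yes _    | no y≢0   = x*y≡0⇒x≡0 y≢0 dy≡0
  ... | yes refl | yes refl = ⊥-elim (w≢0 refl)

  kernel⇒det≡0 : ∀ {A w} → A ·ᵥ w ≡ 0ᵥ → w ≢ 0ᵥ → det A ≡ 0#
  kernel⇒det≡0 {A} {x , y} Aw≡0 =
    annihilator-of-nonzero≡0 (,-injectiveˡ detA·w≡0) (,-injectiveʳ detA·w≡0)
    where
    detA·w≡0 : (det A * x , det A * y) ≡ 0ᵥ
    detA·w≡0 = trans (sym (adj-·ᵥ A x y)) (trans (cong (adj A ·ᵥ_) Aw≡0) (·ᵥ-zeroʳ (adj A)))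

  agree⇒det-‿≡0 : ∀ {A B w} → A ·ᵥ w ≡ B ·ᵥ w → w ≢ 0ᵥ → det (A -ₘ B) ≡ 0#
  agree⇒det-‿≡0 {A} {B} {w} Aw≡Bw = kernel⇒det≡0 (begin
    (A -ₘ B) ·ᵥ w       ≡⟨ ·ᵥ-distribʳ-‿ A B w ⟩
    A ·ᵥ w -ᵥ B ·ᵥ w    ≡⟨ cong (_-ᵥ B ·ᵥ w) Aw≡Bw ⟩
    B ·ᵥ w -ᵥ B ·ᵥ w    ≡⟨ x-ᵥx≡0ᵥ (B ·ᵥ w) ⟩
    0ᵥ                  ∎)

  *ₘ-cancelˡ : ∀ {x A B} → x ≢ 0# → x *ₘ A ≡ x *ₘ B → A ≡ B
  *ₘ-cancelˡ {x} {_ , _ , _ , _} {_ , _ , _ , _} x≢0 xA≡xB =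
    Mat≡ (cancel (cong proj₁ xA≡xB)) (cancel (cong (proj₁ ∘ proj₂) xA≡xB))
         (cancel (cong (proj₁ ∘ proj₂ ∘ proj₂) xA≡xB)) (cancel (cong (proj₂ ∘ proj₂ ∘ proj₂) xA≡xB))
    where
    cancel : ∀ {y z} → x * y ≡ x * z → y ≡ z
    cancel = *-cancelˡ x≢0

  ·-cancelʳ : ∀ {A B M} → Invertible M → A · M ≡ B · M → A ≡ B
  ·-cancelʳ {A} {B} {M} M-inv AM≡BM = *ₘ-cancelˡ M-inv (begin
    det M *ₘ A     ≡⟨ sym (·-adj A M) ⟩
    A · M · adj M  ≡⟨ cong (_· adj M) AM≡BM ⟩
    B · M · adj M  ≡⟨ ·-adj B M ⟩
    det M *ₘ B     ∎)

  x*x≡0⇒x≡0 : ∀ {x} → x * x ≡ 0# → x ≡ 0#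
  x*x≡0⇒x≡0 {x} xx≡0 with x ≟ 0#
  ... | yes x≡0 = x≡0
  ... | no  x≢0 = x*y≡0⇒y≡0 x≢0 xx≡0

  module Singer {t n : Carrier} (irreducible : Irreducible t n) where

    -- u I + v C, where C = (0 , - n , 1 , - t) is the companion matrix of X² + t X + n.
    σ : Vec2 → Mat
    σ (u , v) = (u , - (v * n) , v , u - v * t)

    σ-‿ : ∀ s₁ s₂ → σ s₁ -ₘ σ s₂ ≡ σ (s₁ -ᵥ s₂)
    σ-‿ (u₁ , v₁) (u₂ , v₂) = Mat≡ refl
      (solve 3 (λ v₁ v₂ n → :- (v₁ :* n) :- :- (v₂ :* n) := :- ((v₁ :- v₂) :* n)) refl v₁ v₂ n) refl
      (solve 5 (λ u₁ v₁ u₂ v₂ t → (u₁ :- v₁ :* t) :- (u₂ :- v₂ :* t) := (u₁ :- u₂) :- (v₁ :- v₂) :* t) refl u₁ v₁ u₂ v₂ t)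

    det-σ-scalar : ∀ u → det (σ (u , 0#)) ≡ u * u
    det-σ-scalar u = solve 3 (λ u t n → u :* (u :- con (+ 0) :* t) :- (:- (con (+ 0) :* n)) :* con (+ 0) := u :* u) refl u t n

    -- det σ (u , v) = u² - t u v + n v² is the norm form of 𝔽_{q²} over 𝔽_q.
    det-σ-root : ∀ r v → det (σ (- (r * v) , v)) ≡ (v * v) * (r * r + t * r + n)
    det-σ-root r v = solve 4 (λ r v t n → (:- (r :* v)) :* ((:- (r :* v)) :- v :* t) :- (:- (v :* n)) :* v
                                         := (v :* v) :* (r :* r :+ t :* r :+ n)) refl r v t n

    σ-singular⇒≡0ᵥ : ∀ s → det (σ s) ≡ 0# → s ≡ 0ᵥ
    σ-singular⇒≡0ᵥ (u , v) det≡0 with v ≟ 0#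
    ... | yes refl = cong (_, 0#) (x*x≡0⇒x≡0 (trans (sym (det-σ-scalar u)) det≡0))
    ... | no  v≢0  = ⊥-elim (irreducible r (x*y≡0⇒y≡0 (*-nonzero v≢0 v≢0) (begin
      v * v * (r * r + t * r + n)   ≡⟨ sym (det-σ-root r v) ⟩
      det (σ (- (r * v) , v))       ≡⟨ cong (λ u′ → det (σ (u′ , v))) -rv≡u ⟩
      det (σ (u , v))               ≡⟨ det≡0 ⟩
      0#                            ∎)))
      where
      r : Carrier
      r = - (u * v ⁻¹)
      -rv≡u : - (r * v) ≡ u
      -rv≡u = begin
        - (- (u * v ⁻¹) * v)  ≡⟨ solve 3 (λ u v w → :- (:- (u :* w) :* v) := u :* (v :* w)) refl u v (v ⁻¹) ⟩
        u * (v * v ⁻¹)        ≡⟨ cong (u *_) (inverseʳ v v≢0) ⟩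
        u * 1#                ≡⟨ *-identityʳ u ⟩
        u                     ∎

    σ-invertible : ∀ {s} → s ≢ 0ᵥ → Invertible (σ s)
    σ-invertible {s} s≢0 = s≢0 ∘ σ-singular⇒≡0ᵥ s

    ·σ-injectiveʳ : ∀ {A₁ A₂ s₁ s₂ w} → Invertible A₂ → A₁ ·ᵥ w ≡ A₂ ·ᵥ w → w ≢ 0ᵥ →
                    A₁ · σ s₁ ≡ A₂ · σ s₂ → s₁ ≡ s₂
    ·σ-injectiveʳ {A₁} {A₂} {s₁} {s₂} A₂-inv A₁w≡A₂w w≢0 A₁σ≡A₂σ =
      sym (x-ᵥy≡0ᵥ⇒x≡y (σ-singular⇒≡0ᵥ (s₂ -ᵥ s₁) (x*y≡0⇒y≡0 A₂-inv (begin
        det A₂ * det (σ (s₂ -ᵥ s₁))   ≡⟨ sym (det-· A₂ (σ (s₂ -ᵥ s₁))) ⟩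
        det (A₂ · σ (s₂ -ᵥ s₁))       ≡⟨ cong det (sym difference) ⟩
        det ((A₁ -ₘ A₂) · σ s₁)       ≡⟨ det-· (A₁ -ₘ A₂) (σ s₁) ⟩
        det (A₁ -ₘ A₂) * det (σ s₁)   ≡⟨ cong (_* det (σ s₁)) (agree⇒det-‿≡0 A₁w≡A₂w w≢0) ⟩
        0# * det (σ s₁)               ≡⟨ zeroˡ (det (σ s₁)) ⟩
        0#                            ∎))))
      where
      difference : (A₁ -ₘ A₂) · σ s₁ ≡ A₂ · σ (s₂ -ᵥ s₁)
      difference = begin
        (A₁ -ₘ A₂) · σ s₁          ≡⟨ ·-distribʳ-‿ A₁ A₂ (σ s₁) ⟩
        A₁ · σ s₁ -ₘ A₂ · σ s₁     ≡⟨ cong (_-ₘ A₂ · σ s₁) A₁σ≡A₂σ ⟩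
        A₂ · σ s₂ -ₘ A₂ · σ s₁     ≡⟨ sym (·-distribˡ-‿ A₂ (σ s₂) (σ s₁)) ⟩
        A₂ · (σ s₂ -ₘ σ s₁)        ≡⟨ cong (A₂ ·_) (σ-‿ s₂ s₁) ⟩
        A₂ · σ (s₂ -ᵥ s₁)          ∎

    module _ (p k : ℕ) where

      _·σ_ : ΓL 𝔽 p k → Vec2 → ΓL 𝔽 p k
      (A , i) ·σ s = (A · σ s , i)

      Agree : ΓL 𝔽 p k → ΓL 𝔽 p k → Set
      Agree g h = Σ Vec2 λ v → NonZero2 𝔽 p k v × apply 𝔽 p k g v ≡ apply 𝔽 p k h v

      -- apply 𝔽 p k (A , i) v reduces to A ·ᵥ frobᵥ i v.
      frobᵥ : Fin k → Vec2 → Vec2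
      frobᵥ i (x , y) = (frob^ 𝔽 p k (toℕ i) x , frob^ 𝔽 p k (toℕ i) y)

      frobᵥ-nonzero : ∀ i {v} → v ≢ 0ᵥ → frobᵥ i v ≢ 0ᵥ
      frobᵥ-nonzero i {x , y} v≢0 φv≡0 =
        v≢0 (cong₂ _,_ (pow≡0⇒≡0 (p ^ toℕ i) (,-injectiveˡ φv≡0)) (pow≡0⇒≡0 (p ^ toℕ i) (,-injectiveʳ φv≡0)))

      ·σ-injective : ∀ {g₁ g₂ s₁ s₂} → Invertible (proj₁ g₂) → s₁ ≢ 0ᵥ → Agree g₁ g₂ →
                     g₁ ·σ s₁ ≡ g₂ ·σ s₂ → (g₁ , s₁) ≡ (g₂ , s₂)
      ·σ-injective {A₁ , i} {A₂ , _} {s₁} {s₂} A₂-inv s₁≢0 (v , v≢0 , g₁v≡g₂v) eq with ,-injective eq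
      ... | A₁σ≡A₂σ , refl = cong₂ (λ A s → (A , i) , s) A₁≡A₂ s₁≡s₂
        where
        s₁≡s₂ : s₁ ≡ s₂
        s₁≡s₂ = ·σ-injectiveʳ {w = frobᵥ i v} A₂-inv g₁v≡g₂v (frobᵥ-nonzero i v≢0) A₁σ≡A₂σ
        A₁≡A₂ : A₁ ≡ A₂
        A₁≡A₂ = ·-cancelʳ (σ-invertible s₁≢0) (trans A₁σ≡A₂σ (cong (λ s → A₂ · σ s) (sym s₁≡s₂)))

module Counting (𝔽 : FiniteField) where
  open FiniteField 𝔽
  open Field 𝔽

  nonzero? : (v : Vec2) → Dec (v ≢ 0ᵥ)
  nonzero? v = ¬? (v ≟ᵥ 0ᵥ)

  nonzeroVecs : List Vec2
  nonzeroVecs = filter nonzero? vecs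

  ∈-nonzeroVecs⁻ : ∀ {v} → v ∈ nonzeroVecs → v ≢ 0ᵥ
  ∈-nonzeroVecs⁻ = proj₂ ∘ ∈-filter⁻ nonzero? {xs = vecs}

  order²∸1≤|nonzeroVecs| : order ℕ.* order ∸ 1 ≤ length nonzeroVecs
  order²∸1≤|nonzeroVecs| = ∸-monoˡ-≤ 1
    (subst (_≤ suc (length nonzeroVecs)) (length-cartesianProduct elements elements)
      (Unique⇒length≤ vecs! (λ {v} _ → ∈-0ᵥ∷nonzeroVecs v)))
    where
    ∈-0ᵥ∷nonzeroVecs : ∀ v → v ∈ 0ᵥ ∷ nonzeroVecs
    ∈-0ᵥ∷nonzeroVecs v with v ≟ᵥ 0ᵥ
    ... | yes v≡0 = here v≡0
    ... | no  v≢0 = there (∈-filter⁺ nonzero? (∈-vecs v) v≢0)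

  ∈-GL2 : ∀ {A} → Invertible A → A ∈ GL2
  ∈-GL2 {a , b , c , d} = ∈-filter⁺ (λ A → ¬? (det A ≟ 0#))
    (∈-cartesianProduct⁺ (complete a) (∈-cartesianProduct⁺ (complete b) (∈-cartesianProduct⁺ (complete c) (complete d))))

  module _ (p k : ℕ) where
    open Singer (proj₂ (proj₂ ∃-irreducible))

    intersecting-bound : (𝓕 : List (ΓL 𝔽 p k)) → All (Invertible ∘ proj₁) 𝓕 → Unique 𝓕 →
                         Intersecting 𝔽 p k 𝓕 → length 𝓕 ℕ.* length nonzeroVecs ≤ |ΓL| 𝔽 p k
    intersecting-bound 𝓕 invertible 𝓕! intersecting = begin
      length 𝓕 ℕ.* length nonzeroVecs            ≡⟨ length-cartesianProduct 𝓕 nonzeroVecs ⟨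
      length (cartesianProduct 𝓕 nonzeroVecs)     ≤⟨ injectiveOn⇒length≤ (uncurry (_·σ_ p k)) 𝓕×nonzero! into injective ⟩
      length (cartesianProduct GL2 (allFin k))    ≡⟨ length-cartesianProduct GL2 (allFin k) ⟩
      length GL2 ℕ.* length (allFin k)            ≡⟨ cong (length GL2 ℕ.*_) (length-tabulate id) ⟩
      |ΓL| 𝔽 p k                                  ∎
      where
      open ≤-Reasoning
      𝓕×nonzero! : Unique (cartesianProduct 𝓕 nonzeroVecs)
      𝓕×nonzero! = Unique.cartesianProduct⁺ 𝓕! (Unique.filter⁺ nonzero? vecs!)
      ∈-𝓕×nonzero⁻ : ∀ {g s} → (g , s) ∈ cartesianProduct 𝓕 nonzeroVecs → g ∈ 𝓕 × s ≢ 0ᵥ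
      ∈-𝓕×nonzero⁻ gs∈ = let (g∈ , s∈) = ∈-cartesianProduct⁻ 𝓕 nonzeroVecs gs∈ in g∈ , ∈-nonzeroVecs⁻ s∈
      into : MapsInto (uncurry (_·σ_ p k)) (cartesianProduct 𝓕 nonzeroVecs) (cartesianProduct GL2 (allFin k))
      into {(A , i) , s} gs∈ = ∈-cartesianProduct⁺ (∈-GL2 Aσ-invertible) (∈-allFin i)
        where
        Aσ-invertible : Invertible (A · σ s)
        Aσ-invertible =
          let (g∈ , s≢0) = ∈-𝓕×nonzero⁻ gs∈ in
          λ detAσ≡0 → *-nonzero (All.lookup invertible g∈) (σ-invertible s≢0) (trans (sym (det-· A (σ s))) detAσ≡0)
      injective : InjectiveOn (uncurry (_·σ_ p k)) (cartesianProduct 𝓕 nonzeroVecs)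
      injective gs₁∈ gs₂∈ =
        let (g₁∈ , s₁≢0) = ∈-𝓕×nonzero⁻ gs₁∈
            (g₂∈ , _)    = ∈-𝓕×nonzero⁻ gs₂∈
        in ·σ-injective p k (All.lookup invertible g₂∈) s₁≢0 (intersecting g₁∈ g₂∈)

-- Imported only here: above, it would clash with the field multiplication.
open import Data.Nat using (_*_)

lemma2p2 : (𝔽 : FiniteField) (p k : ℕ) → Prime p → k ≥ 1 →
    FiniteField.order 𝔽 ≡ p ^ k →
    (𝓕 : List (ΓL 𝔽 p k)) →
    All (FiniteField.Invertible 𝔽 ∘ proj₁) 𝓕 → Unique 𝓕 →
    Intersecting 𝔽 p k 𝓕 →
    length 𝓕 * (p ^ k * p ^ k ∸ 1) ≤ |ΓL| 𝔽 p k
lemma2p2 𝔽 p k _ _ q≡pᵏ 𝓕 invertible 𝓕! intersecting =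
  subst (λ q → length 𝓕 * (q * q ∸ 1) ≤ |ΓL| 𝔽 p k) q≡pᵏ (begin
    length 𝓕 * (order * order ∸ 1)   ≤⟨ *-monoʳ-≤ (length 𝓕) order²∸1≤|nonzeroVecs| ⟩
    length 𝓕 * length nonzeroVecs    ≤⟨ intersecting-bound p k 𝓕 invertible 𝓕! intersecting ⟩
    |ΓL| 𝔽 p k                       ∎)
  where
  open ≤-Reasoning
  open FiniteField 𝔽 using (order)
  open Counting 𝔽 using (nonzeroVecs; order²∸1≤|nonzeroVecs|; intersecting-bound)
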